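{- If $G$ is a bipartite graph with $\Delta(G)\le6$, then $\mathrm{def}_c(G)\le|V_3|$, where $V_3$ is the set of vertices of degree $3$ in $G$.
   Context: All graphs are finite, simple and undirected; $\Delta(G)$ denotes the maximum degree. A set $A\subseteq\{1,\dots,t\}$ is a cyclic interval modulo $t$ if $A$ or $\{1,\dots,t\}\setminus A$ is an interval of integers; a cyclic interval $t$-coloring is a proper edge coloring with colors $1,\dots,t$ in which the set of colors at every vertex is a cyclic interval modulo $t$. The cyclic deficiency $\mathrm{def}_c(G)$ is the minimum number of pendant edges whose attachment to $G$ yields a graph admitting a cyclic interval coloring. -}

module Defs where

open import Data.Nat using (ℕ; _≤_; _+_; _≡ᵇ_)
open import Data.Fin using (Fin; splitAt; toℕ)
open import Data.Sum using (_⊎_; inj₁; inj₂)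
open import Data.Bool using (Bool; true; false; _∧_)
open import Data.List using (length; filterᵇ)
open import Data.List using () renaming (allFin to allFinL)
open import Data.Product using (Σ; ∃; ∃-syntax; _×_; _,_)
open import Relation.Nullary using (¬_)
open import Relation.Binary.PropositionalEquality using (_≡_; _≢_)
open import Function.Bundles using (_⇔_)

record Graph (n : ℕ) : Set where
  field
    adj     : Fin n → Fin n → Bool
    symm    : ∀ u v → adj u v ≡ adj v u
    irrefl  : ∀ v → adj v v ≡ false
open Graph public

deg : ∀ {n} → Graph n → Fin n → ℕ
deg {n} G v = length (filterᵇ (adj G v) (allFinL n))

MaxDegAtMost : ∀ {n} → Graph n → ℕ → Set
MaxDegAtMost G d = ∀ v → deg G v ≤ d

numDeg3 : ∀ {n} → Graph n → ℕ
numDeg3 {n} G = length (filterᵇ (λ v → deg G v ≡ᵇ 3) (allFinL n))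

Bipartite : ∀ {n} → Graph n → Set
Bipartite {n} G = Σ (Fin n → Bool) λ side →
  ∀ (u v : Fin n) → adj G u v ≡ true → side u ≢ side v

-- Attaching k pendant edges: new vertices n, …, n+k-1; the i-th new vertex
-- is a leaf adjacent exactly to the original vertex  att i.
-- (The result is again symmetric and irreflexive by construction.)
pendAdj : ∀ {n k} → Graph n → (Fin k → Fin n) → Fin (n + k) → Fin (n + k) → Bool
pendAdj {n} {k} G att x y with splitAt n x | splitAt n y
... | inj₁ u | inj₁ v = adj G u v
... | inj₁ u | inj₂ j = toℕ u ≡ᵇ toℕ (att j)
... | inj₂ i | inj₁ v = toℕ (att i) ≡ᵇ toℕ v
... | inj₂ i | inj₂ j = false

-- A set of naturals (given as a predicate) is an interval of integers
-- {a, …, b}; a > b gives the empty interval.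
IsInterval : (ℕ → Set) → Set
IsInterval P = ∃[ a ] ∃[ b ] ∀ c → (P c ⇔ (a ≤ c × c ≤ b))

IsCyclicInterval : ℕ → (ℕ → Set) → Set
IsCyclicInterval t A = IsInterval A ⊎ IsInterval (λ c → 1 ≤ c × c ≤ t × ¬ A c)

coloursAt : ∀ {m} → (Fin m → Fin m → Bool) → (Fin m → Fin m → ℕ) → Fin m → ℕ → Set
coloursAt adj′ col v c = ∃[ u ] (adj′ v u ≡ true × col v u ≡ c)

-- a cyclic interval t-colouring of the graph with adjacency adj′:
-- an edge colouring (col u v = col v u is the colour of edge uv) with colours
-- in {1..t}, proper, and with a cyclic interval of colours at each vertex.
record CyclicIntervalColouring {m} (adj′ : Fin m → Fin m → Bool) (t : ℕ)
                                (col : Fin m → Fin m → ℕ) : Set where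
  field
    colSym   : ∀ u v → adj′ u v ≡ true → col u v ≡ col v u
    inRange  : ∀ u v → adj′ u v ≡ true → 1 ≤ col u v × col u v ≤ t
    proper   : ∀ u v w → adj′ u v ≡ true → adj′ u w ≡ true → v ≢ w → col u v ≢ col u w
    cyclic   : ∀ v → IsCyclicInterval t (coloursAt adj′ col v)

HasCyclicIntervalColouring : ∀ {m} → (Fin m → Fin m → Bool) → Set
HasCyclicIntervalColouring adj′ = ∃[ t ] ∃[ col ] CyclicIntervalColouring adj′ t col

-- def_c(G) ≤ d : some attachment of at most d pendant edges admits a
-- cyclic interval colouring.
DefcAtMost : ∀ {n} → Graph n → ℕ → Set
DefcAtMost {n} G d = ∃[ k ] (k ≤ d × ∃[ att ] HasCyclicIntervalColouring (pendAdj {n} {k} G att))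

-- Attaching a pendant edge to each vertex of degree 3 leaves a bipartite
-- graph with all degrees in {0, 1, 2, 4, 5, 6}, and such a graph has a cyclic
-- interval 6-colouring.  The colours form the blocks {1,2}, {3,4}, {5,6}, and
-- the colouring comes from three applications of König's theorem.  First a
-- 2-edge-colouring σ separates the two edges to each pair of consecutive
-- neighbours of a vertex.  Splitting every vertex into two halves along σ,
-- and joining the halves of a vertex of degree 2 (resp. 4) by two (resp. one)
-- dummy edges, gives a graph of maximum degree 3; its 3-edge-colouring β picks
-- the block of each edge.  Finally a 2-edge-colouring π separates the at most
-- two edges of one block at a vertex.  At a vertex of degree 2 or 4 the blocks
-- of the dummies are excluded, so its edges fill up the remaining blocks; at
-- degree 5 exactly one colour is missing, and at degree 6 none.
module Submission where

open import Defs
open import Data.Bool using (Bool; true; false; not; _∧_; _xor_; if_then_else_)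
open import Data.Bool.Properties using (T-≡; T?; xor-same; not-¬) renaming (_≟_ to _≟ᴮ_)
open import Data.Empty using (⊥; ⊥-elim)
open import Data.Fin as Fin using (Fin; zero; suc; toℕ; fromℕ<; _≟_; combine; remQuot; splitAt; join; _↑ˡ_; _↑ʳ_; inject≤)
open import Data.Fin.Permutation.Components using (transpose; transpose-inverse)
open import Data.Fin.Properties
  using (cantor-schröder-bernstein; any?; all?; ¬∀⟶∃¬; pigeonhole; <⇒notInjective; toℕ<n; toℕ-injective; suc-injective;
         toℕ-fromℕ<; fromℕ<-injective; join-splitAt; splitAt-↑ˡ; splitAt-↑ʳ; ↑ˡ-injective; ↑ʳ-injective; toℕ-inject≤;
         inject≤-injective; combine-injective; toℕ-combine; combine-remQuot; remQuot-combine)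
open import Data.List using (List; _∷_; length; lookup; filterᵇ)
open import Data.List using () renaming (allFin to allFinL)
open import Data.List.Membership.Propositional using (_∈_)
open import Data.List.Membership.Propositional.Properties using (∈-filter⁺; ∈-filter⁻; ∈-lookup; ∈-allFin)
import Data.List.Relation.Unary.All as All
open import Data.List.Relation.Unary.Any using (index)
open import Data.List.Relation.Unary.Any.Properties using (lookup-index)
open import Data.List.Relation.Unary.AllPairs using (_∷_)
open import Data.List.Relation.Unary.Unique.Propositional using (Unique)
open import Data.List.Relation.Unary.Unique.Propositional.Properties using (allFin⁺; filter⁺)
open import Data.Maybe using (Maybe; just; nothing)
import Data.Maybe.Properties as MaybeP
open import Data.Nat using (ℕ; zero; suc; _+_; _*_; _∸_; NonZero; _<ᵇ_; _≡ᵇ_; _≤_; _<_; z≤n; s≤s)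
open import Data.Nat.DivMod using (_/_; _%_; m≡m%n+[m/n]*n; m%n<n; m<n*o⇒m/o<n)
open import Data.Nat.Properties as ℕP
  using (≤-refl; ≤-trans; ≤-antisym; ≤-pred; <-≤-trans; ≮⇒≥; _<?_; m≤n⇒m<n∨m≡n; <ᵇ⇒<; <⇒<ᵇ; ≡ᵇ⇒≡; ≡⇒≡ᵇ;
         m≤m+n; +-monoʳ-≤; +-monoʳ-<; +-cancelˡ-≡; +-identityʳ; +-suc; m∸n≤m; m∸n+n≡m; m+[n∸m]≡n; m<n+o⇒m∸n<o)
open import Data.Product using (Σ-syntax; ∃-syntax; _×_; _,_; proj₁; proj₂; uncurry)
open import Data.Sum using (_⊎_; inj₁; inj₂; [_,_]′)
open import Data.Sum.Properties using (≡-dec)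
import Data.Product.Properties as ×P
import Data.Vec.Functional as Vector
open import Function.Bundles using (_⇔_; mk⇔; Equivalence)
open import Function.Definitions using (Injective)
open import Relation.Binary using (DecidableEquality)
open import Relation.Binary.PropositionalEquality using (_≡_; _≢_; refl; sym; trans; cong; cong₂; subst)
open import Relation.Nullary using (¬_; Dec; yes; no; contradiction)
open import Relation.Nullary.Decidable using (_×-dec_; _⊎-dec_; ¬?; dec-true; dec-false)

AtMost : ∀ {m} → ℕ → (Fin m → Set) → Set
AtMost {m} k P = (f : Fin (suc k) → Fin m) → Injective _≡_ _≡_ f → ¬ (∀ c → P (f c))

-- A bipartite multigraph with edge set Fin m is given by its two endpoint
-- maps l : Fin m → L and r : Fin m → R; end is either of them.
module _ {A : Set} {m : ℕ} (end : Fin m → A) where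

  DegreeAtMost : ℕ → Set
  DegreeAtMost k = ∀ x → AtMost k (λ e → end e ≡ x)

  Proper : ∀ {k} → (Fin m → Fin k) → Set
  Proper col = ∀ e e′ → e ≢ e′ → end e ≡ end e′ → col e ≢ col e′

  Missing : ∀ {k} → (Fin m → Fin k) → A → Fin k → Set
  Missing col x α = ∀ e → end e ≡ x → col e ≢ α

module _ {A : Set} {m k : ℕ} (end : Fin (suc m) → A) where

  private
    end′ : Fin m → A
    end′ e = end (suc e)

  DegreeAtMost-tail : DegreeAtMost end k → DegreeAtMost end′ k
  DegreeAtMost-tail deg x f f-inj = deg x (λ c → suc (f c)) (λ q → f-inj (suc-injective q))

  Proper-∷ : ∀ (col : Fin m → Fin k) α → Proper end′ col → Missing end′ col (end zero) α → Proper end (α Vector.∷ col)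
  Proper-∷ col α p miss zero    zero     e≢e′ _ _ = e≢e′ refl
  Proper-∷ col α p miss zero    (suc e′) _    q c = miss e′ (sym q) (sym c)
  Proper-∷ col α p miss (suc e) zero     _    q c = miss e q c
  Proper-∷ col α p miss (suc e) (suc e′) e≢e′ q c = p e e′ (λ h → e≢e′ (cong suc h)) q c

  module _ (_≟A_ : DecidableEquality A) (col : Fin m → Fin k) where
    private
      Used : Fin k → Set
      Used α = ∃[ e ] (end′ e ≡ end zero × col e ≡ α)

      Used? : ∀ α → Dec (Used α)
      Used? α = any? (λ e → (end′ e ≟A end zero) ×-dec (col e ≟ α))

    missingColour : DegreeAtMost end k → ∃[ α ] Missing end′ col (end zero) α
    missingColour deg with all? Used?
    ... | no ¬allUsed = let (α , unused) = ¬∀⟶∃¬ _ _ Used? ¬allUsed in α , λ e q c → unused (e , q , c)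
    ... | yes allUsed = ⊥-elim (deg (end zero) f f-inj f-end)
      where
      f : Fin (suc k) → Fin (suc m)
      f zero    = zero
      f (suc c) = suc (proj₁ (allUsed c))
      f-inj : Injective _≡_ _≡_ f
      f-inj {zero}  {zero}  _ = refl
      f-inj {suc i} {suc j} q = cong suc (trans (sym (proj₂ (proj₂ (allUsed i))))
                                  (trans (cong col (suc-injective q)) (proj₂ (proj₂ (allUsed j)))))
      f-end : ∀ c → end (f c) ≡ end zero
      f-end zero    = refl
      f-end (suc c) = proj₁ (proj₂ (allUsed c))

module KempeChain {L R : Set} {m k : ℕ} (_≟L_ : DecidableEquality L) (_≟R_ : DecidableEquality R)
    (l : Fin m → L) (r : Fin m → R) (col : Fin m → Fin k) (proper-l : Proper l col) (proper-r : Proper r col)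
    (α β : Fin k) (α≢β : α ≢ β) (x : L) (y : R)
    (α-missing-x : Missing l col x α) (β-missing-y : Missing r col y β)
    (e₁ : Fin m) (e₁-at-y : r e₁ ≡ y) (e₁-α : col e₁ ≡ α) where

  IsAB : Fin k → Set
  IsAB c = c ≡ α ⊎ c ≡ β

  InAB : Fin m → Set
  InAB e = IsAB (col e)

  β-if-not-α : ∀ {e} → InAB e → col e ≢ α → col e ≡ β
  β-if-not-α (inj₁ eα) e≢α = contradiction eα e≢α
  β-if-not-α (inj₂ eβ) _   = eβ

  α-if-not-β : ∀ {e} → InAB e → col e ≢ β → col e ≡ α
  α-if-not-β (inj₁ eα) _   = eα
  α-if-not-β (inj₂ eβ) e≢β = contradiction eβ e≢β

  unique-l : ∀ {e e′} → l e ≡ l e′ → col e ≡ col e′ → e ≡ e′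
  unique-l {e} {e′} q c with e ≟ e′
  ... | yes e≡e′ = e≡e′
  ... | no e≢e′  = contradiction c (proper-l e e′ e≢e′ q)

  unique-r : ∀ {e e′} → r e ≡ r e′ → col e ≡ col e′ → e ≡ e′
  unique-r {e} {e′} q c with e ≟ e′
  ... | yes e≡e′ = e≡e′
  ... | no e≢e′  = contradiction c (proper-r e e′ e≢e′ q)

  -- The α/β path from y leaves each α-edge at its l-end along a β-edge and
  -- each β-edge at its r-end along an α-edge.
  Link : Fin m → Fin m → Set
  Link e e′ = (col e ≡ α × col e′ ≡ β × l e′ ≡ l e) ⊎ (col e ≢ α × col e′ ≡ α × r e′ ≡ r e)

  Link? : ∀ e e′ → Dec (Link e e′)
  Link? e e′ = ((col e ≟ α) ×-dec (col e′ ≟ β) ×-dec (l e′ ≟L l e))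
          ⊎-dec (¬? (col e ≟ α) ×-dec (col e′ ≟ α) ×-dec (r e′ ≟R r e))

  next : Fin m → Maybe (Fin m)
  next e with any? (Link? e)
  ... | yes (e′ , _) = just e′
  ... | no _         = nothing

  next-link : ∀ {e e′} → next e ≡ just e′ → Link e e′
  next-link {e} q with any? (Link? e)
  next-link refl | yes (_ , link) = link

  next-nothing : ∀ {e e′} → next e ≡ nothing → ¬ Link e e′
  next-nothing {e} {e′} q link with any? (Link? e)
  ... | no ¬link = ¬link (e′ , link)

  link-InAB : ∀ {e e′} → Link e e′ → InAB e′
  link-InAB (inj₁ (_ , e′β , _)) = inj₂ e′β
  link-InAB (inj₂ (_ , e′α , _)) = inj₁ e′α

  link-injective : ∀ {a b e} → InAB a → InAB b → Link a e → Link b e → a ≡ b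
  link-injective _ _ (inj₁ (aα , _ , la)) (inj₁ (bα , _ , lb)) = unique-l (trans (sym la) lb) (trans aα (sym bα))
  link-injective _ _ (inj₁ (_ , eβ , _)) (inj₂ (_ , eα , _)) = contradiction (trans (sym eα) eβ) α≢β
  link-injective _ _ (inj₂ (_ , eα , _)) (inj₁ (_ , eβ , _)) = contradiction (trans (sym eα) eβ) α≢β
  link-injective a∈ b∈ (inj₂ (a≢α , _ , ra)) (inj₂ (b≢α , _ , rb)) =
    unique-r (trans (sym ra) rb) (trans (β-if-not-α a∈ a≢α) (sym (β-if-not-α b∈ b≢α)))

  no-link-to-e₁ : ∀ {a} → InAB a → ¬ Link a e₁
  no-link-to-e₁ _ (inj₁ (_ , e₁β , _)) = α≢β (trans (sym e₁-α) e₁β)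
  no-link-to-e₁ a∈ (inj₂ (a≢α , _ , ra)) = β-missing-y _ (trans (sym ra) e₁-at-y) (β-if-not-α a∈ a≢α)

  chain : ℕ → Maybe (Fin m)
  chain zero    = just e₁
  chain (suc i) with chain i
  ... | just e  = next e
  ... | nothing = nothing

  chain-pred : ∀ i {e} → chain (suc i) ≡ just e → ∃[ a ] (chain i ≡ just a × Link a e)
  chain-pred i q with chain i
  ... | just a = a , refl , next-link q

  chain-InAB : ∀ i {e} → chain i ≡ just e → InAB e
  chain-InAB zero    refl = inj₁ e₁-α
  chain-InAB (suc i) q    = link-InAB (proj₂ (proj₂ (chain-pred i q)))

  chain-injective : ∀ i j {e} → chain i ≡ just e → chain j ≡ just e → i < j → ⊥
  chain-injective zero (suc j) refl q _ =
    let (a , ca , link) = chain-pred j q in no-link-to-e₁ (chain-InAB j ca) link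
  chain-injective (suc i) (suc j) p q (s≤s i<j) with chain-pred i p | chain-pred j q
  ... | a , ca , la | b , cb , lb with link-injective (chain-InAB i ca) (chain-InAB j cb) la lb
  ... | refl = chain-injective i j ca cb i<j

  Defined : ℕ → Set
  Defined i = ∃[ e ] chain i ≡ just e

  Defined-≤ : ∀ {i j} → i ≤ j → Defined j → Defined i
  Defined-≤ {j = zero}  z≤n d = d
  Defined-≤ {j = suc j} i≤j d with m≤n⇒m<n∨m≡n i≤j
  ... | inj₂ refl       = d
  ... | inj₁ (s≤s i≤j′) = Defined-≤ i≤j′ (let (a , ca , _) = chain-pred j (proj₂ d) in a , ca)

  -- The path never repeats an edge, so it stops within m steps.
  chain-undefined-at-m : chain m ≡ nothing
  chain-undefined-at-m with chain m in eq
  ... | nothing = refl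
  ... | just e  = ⊥-elim (repetition (pigeonhole ≤-refl position))
    where
    defined : (i : Fin (suc m)) → Defined (toℕ i)
    defined i = Defined-≤ (≤-pred (toℕ<n i)) (e , eq)
    position : Fin (suc m) → Fin m
    position i = proj₁ (defined i)
    repetition : ¬ (∃[ i ] ∃[ j ] (i Fin.< j × position i ≡ position j))
    repetition (i , j , i<j , q) = chain-injective (toℕ i) (toℕ j) (proj₂ (defined i))
      (subst (λ z → chain (toℕ j) ≡ just z) (sym q) (proj₂ (defined j))) i<j

  chain-undefined : ∀ {i} → m ≤ i → chain i ≡ nothing
  chain-undefined {i} m≤i with chain i in eq
  ... | nothing = refl
  ... | just e with trans (sym (proj₂ (Defined-≤ m≤i (e , eq)))) chain-undefined-at-m
  ... | ()

  chain-suc : ∀ {i e} → chain i ≡ just e → chain (suc i) ≡ next e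
  chain-suc {i} q with chain i
  chain-suc refl | just _ = refl

  InChain : Fin m → Set
  InChain e = ∃[ i ] chain (toℕ {m} i) ≡ just e

  InChain? : ∀ e → Dec (InChain e)
  InChain? e = any? (λ i → MaybeP.≡-dec _≟_ (chain (toℕ i)) (just e))

  chain-InChain : ∀ i {e} → chain i ≡ just e → InChain e
  chain-InChain i {e} q with i <? m
  ... | yes i<m = fromℕ< i<m , subst (λ j → chain j ≡ just e) (sym (toℕ-fromℕ< i<m)) q
  ... | no i≮m with trans (sym q) (chain-undefined (≮⇒≥ i≮m))
  ... | ()

  InChain-InAB : ∀ {e} → InChain e → InAB e
  InChain-InAB (i , q) = chain-InAB (toℕ i) q

  link-deterministic : ∀ {e f f′} → Link e f → Link e f′ → f ≡ f′
  link-deterministic (inj₁ (_ , fβ , lf)) (inj₁ (_ , f′β , lf′)) = unique-l (trans lf (sym lf′)) (trans fβ (sym f′β))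
  link-deterministic (inj₁ (eα , _)) (inj₂ (e≢α , _)) = contradiction eα e≢α
  link-deterministic (inj₂ (e≢α , _)) (inj₁ (eα , _)) = contradiction eα e≢α
  link-deterministic (inj₂ (_ , fα , rf)) (inj₂ (_ , f′α , rf′)) = unique-r (trans rf (sym rf′)) (trans fα (sym f′α))

  InChain-next : ∀ {e e′} → InChain e → Link e e′ → InChain e′
  InChain-next {e} {e′} (i , ci) link with next e in eq
  ... | just f  = chain-InChain (suc (toℕ i))
                    (trans (chain-suc {toℕ i} ci) (trans eq (cong just (link-deterministic (next-link eq) link))))
  ... | nothing = contradiction link (next-nothing eq)

  InChain-pred : ∀ {e} → InChain e → e ≡ e₁ ⊎ ∃[ a ] (InChain a × Link a e)
  InChain-pred (i , ci) = go (toℕ i) ci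
    where
    go : ∀ j {e} → chain j ≡ just e → e ≡ e₁ ⊎ ∃[ a ] (InChain a × Link a e)
    go zero    refl = inj₁ refl
    go (suc j) cj   = let (a , ca , link) = chain-pred j cj in inj₂ (a , chain-InChain j ca , link)

  InChain-closed-l : ∀ {e e′} → InChain e → InAB e′ → col e′ ≢ col e → l e′ ≡ l e → InChain e′
  InChain-closed-l {e} {e′} e∈ e′∈ c≢ le with col e ≟ α
  ... | yes eα = InChain-next e∈ (inj₁ (eα , β-if-not-α e′∈ (λ e′α → c≢ (trans e′α (sym eα))) , le))
  ... | no e≢α with InChain-pred e∈
  ...   | inj₁ refl = contradiction e₁-α e≢α
  ...   | inj₂ (a , a∈ , inj₂ (_ , eα , _)) = contradiction eα e≢α
  ...   | inj₂ (a , a∈ , inj₁ (aα , _ , la)) = subst InChain (sym (unique-l (trans le la) (trans e′α (sym aα)))) a∈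
    where
    e′α : col e′ ≡ α
    e′α = α-if-not-β e′∈ (λ e′β → c≢ (trans e′β (sym (β-if-not-α (InChain-InAB e∈) e≢α))))

  InChain-closed-r : ∀ {e e′} → InChain e → InAB e′ → col e′ ≢ col e → r e′ ≡ r e → InChain e′
  InChain-closed-r {e} {e′} e∈ e′∈ c≢ re with col e ≟ α
  ... | no e≢α = InChain-next e∈ (inj₂ (e≢α , e′α , re))
    where
    e′α : col e′ ≡ α
    e′α = α-if-not-β e′∈ (λ e′β → c≢ (trans e′β (sym (β-if-not-α (InChain-InAB e∈) e≢α))))
  ... | yes eα with InChain-pred e∈
  ...   | inj₁ refl = contradiction e′β (β-missing-y e′ (trans re e₁-at-y))
    where
    e′β : col e′ ≡ β
    e′β = β-if-not-α e′∈ (λ e′α → c≢ (trans e′α (sym eα)))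
  ...   | inj₂ (a , a∈ , inj₁ (_ , eβ , _)) = contradiction (trans (sym eα) eβ) α≢β
  ...   | inj₂ (a , a∈ , inj₂ (a≢α , _ , ra)) =
    subst InChain (sym (unique-r (trans re ra) (trans e′β (sym (β-if-not-α (InChain-InAB a∈) a≢α))))) a∈
    where
    e′β : col e′ ≡ β
    e′β = β-if-not-α e′∈ (λ e′α → c≢ (trans e′α (sym eα)))

  swap : Fin k → Fin k
  swap = transpose α β

  swap-α : swap α ≡ β
  swap-α rewrite dec-true (α ≟ α) refl = refl

  swap-β : swap β ≡ α
  swap-β rewrite dec-false (β ≟ α) (λ βα → α≢β (sym βα)) | dec-true (β ≟ β) refl = refl

  swap-injective : ∀ {c d} → swap c ≡ swap d → c ≡ d
  swap-injective q = trans (sym (transpose-inverse β α)) (trans (cong (transpose β α) q) (transpose-inverse β α))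

  swap-α-≢α : ∀ {c} → c ≡ α → swap c ≢ α
  swap-α-≢α refl q = α≢β (sym (trans (sym swap-α) q))

  swap-IsAB : ∀ {c} → IsAB c → IsAB (swap c)
  swap-IsAB (inj₁ refl) = inj₂ swap-α
  swap-IsAB (inj₂ refl) = inj₁ swap-β

  swap-moves : ∀ {c} → IsAB c → swap c ≢ c
  swap-moves (inj₁ refl) q = α≢β (trans (sym q) swap-α)
  swap-moves (inj₂ refl) q = α≢β (trans (sym swap-β) q)

  recolour : Fin m → Fin k
  recolour e with InChain? e
  ... | yes _ = swap (col e)
  ... | no _  = col e

  recolour-proper : ∀ {A : Set} (end : Fin m → A) → Proper end col →
    (∀ {e e′} → InChain e → InAB e′ → col e′ ≢ col e → end e′ ≡ end e → InChain e′) → Proper end recolour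
  recolour-proper end p closed e e′ e≢e′ q c with InChain? e | InChain? e′
  ... | yes _  | yes _   = p e e′ e≢e′ q (swap-injective c)
  ... | no _   | no _    = p e e′ e≢e′ q c
  ... | yes e∈ | no e′∉ = e′∉ (closed e∈ (subst IsAB c (swap-IsAB (InChain-InAB e∈)))
                                          (λ c′ → swap-moves (InChain-InAB e∈) (trans c c′)) (sym q))
  ... | no e∉  | yes e′∈ = e∉ (closed e′∈ (subst IsAB (sym c) (swap-IsAB (InChain-InAB e′∈)))
                                          (λ c′ → swap-moves (InChain-InAB e′∈) (trans (sym c) c′)) q)

  α-missing-x-after : Missing l recolour x α
  α-missing-x-after e le c with InChain? e
  ... | no _   = α-missing-x e le c
  ... | yes e∈ with InChain-pred e∈
  ...   | inj₁ refl = swap-α-≢α e₁-α c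
  ...   | inj₂ (a , _ , inj₁ (aα , _ , la)) = α-missing-x a (trans (sym la) le) aα
  ...   | inj₂ (a , _ , inj₂ (_ , eα , _)) = swap-α-≢α eα c

  α-missing-y-after : Missing r recolour y α
  α-missing-y-after e re c with InChain? e
  ... | yes e∈ = β-missing-y e re (β-if-not-α (InChain-InAB e∈) (λ eα → swap-α-≢α eα c))
  ... | no e∉  = e∉ (subst InChain (unique-r (trans e₁-at-y (sym re)) (trans e₁-α (sym c))) (chain-InChain 0 refl))

-- The last edge
-- xy is added to a colouring of the others: α is missing at x and β at y,
-- and if α is present at y, swapping α and β along the α/β path from y frees α
-- at y; the path cannot reach x, as it arrives on the side of x only along α-edges.
konig : ∀ {L R : Set} → DecidableEquality L → DecidableEquality R →
  ∀ {m k} (l : Fin m → L) (r : Fin m → R) → DegreeAtMost l k → DegreeAtMost r k →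
  Σ[ col ∈ (Fin m → Fin k) ] (Proper l col × Proper r col)
konig _ _ {zero} l r _ _ = (λ ()) , (λ ()) , (λ ())
konig _≟L_ _≟R_ {suc m} l r deg-l deg-r
  with konig _≟L_ _≟R_ (λ e → l (suc e)) (λ e → r (suc e))
             (DegreeAtMost-tail l deg-l) (DegreeAtMost-tail r deg-r)
... | col , proper-l , proper-r
  with missingColour l _≟L_ col deg-l | missingColour r _≟R_ col deg-r
... | α , α-missing-x | β , β-missing-y
  with any? (λ e → (r (suc e) ≟R r zero) ×-dec (col e ≟ α))
... | no α-missing-y =
  α Vector.∷ col , Proper-∷ l col α proper-l α-missing-x
                 , Proper-∷ r col α proper-r (λ e q c → α-missing-y (e , q , c))
... | yes (e₁ , e₁-at-y , e₁-α) =
  α Vector.∷ recolour , Proper-∷ l recolour α (recolour-proper (λ e → l (suc e)) proper-l InChain-closed-l) α-missing-x-after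
                      , Proper-∷ r recolour α (recolour-proper (λ e → r (suc e)) proper-r InChain-closed-r) α-missing-y-after
  where
  open KempeChain _≟L_ _≟R_ (λ e → l (suc e)) (λ e → r (suc e)) col proper-l proper-r α β
         (λ α≡β → β-missing-y e₁ e₁-at-y (trans e₁-α α≡β)) (l zero) (r zero) α-missing-x β-missing-y
         e₁ e₁-at-y e₁-α

At : ∀ {V : Set} {m} → (Fin m → Bool) → (Fin m → V) → (Fin m → V) → Fin m → V → Set
At active left right e w = active e ≡ true × (left e ≡ w ⊎ right e ≡ w)

module _ {V : Set} (_≟V_ : DecidableEquality V) {m : ℕ} (active : Fin m → Bool) (left right : Fin m → V) where

  private
    -- Each inactive edge gets a private endpoint, so that it constrains nothing.
    endpoint : (Fin m → V) → Fin m → V ⊎ Fin m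
    endpoint end e = if active e then inj₁ (end e) else inj₂ e

    endpoint-active : ∀ end {e} → active e ≡ true → endpoint end e ≡ inj₁ (end e)
    endpoint-active end {e} a rewrite a = refl

    endpoint-inj₁ : ∀ end {e w} → endpoint end e ≡ inj₁ w → active e ≡ true × end e ≡ w
    endpoint-inj₁ end {e} q with active e
    endpoint-inj₁ end refl | true = refl , refl

    endpoint-inj₂ : ∀ end {e z} → endpoint end e ≡ inj₂ z → e ≡ z
    endpoint-inj₂ end {e} q with active e
    endpoint-inj₂ end refl | false = refl

    endpoint-degree : ∀ {k} end → (∀ {e w} → active e ≡ true → end e ≡ w → At active left right e w) →
      (∀ w → AtMost (suc k) (λ e → At active left right e w)) → DegreeAtMost (endpoint end) (suc k)
    endpoint-degree end at deg (inj₁ w) f f-inj f-at =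
      deg w f f-inj (λ c → let (a , q) = endpoint-inj₁ end (f-at c) in at a q)
    endpoint-degree end at deg (inj₂ z) f f-inj f-at with
      f-inj (trans (endpoint-inj₂ end (f-at zero)) (sym (endpoint-inj₂ end (f-at (suc zero)))))
    ... | ()

  colourActiveEdges : ∀ {k} (side : V → Bool) →
    (∀ {e} → active e ≡ true → side (left e) ≡ false) → (∀ {e} → active e ≡ true → side (right e) ≡ true) →
    (∀ w → AtMost (suc k) (λ e → At active left right e w)) →
    Σ[ col ∈ (Fin m → Fin (suc k)) ]
      (∀ {e e′ w} → At active left right e w → At active left right e′ w → e ≢ e′ → col e ≢ col e′)
  colourActiveEdges side left-side right-side deg
    with konig (≡-dec _≟V_ _≟_) (≡-dec _≟V_ _≟_) (endpoint left) (endpoint right)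
           (endpoint-degree left (λ a q → a , inj₁ q) deg) (endpoint-degree right (λ a q → a , inj₂ q) deg)
  ... | col , proper-l , proper-r = col , proper
    where
    proper : ∀ {e e′ w} → At active left right e w → At active left right e′ w → e ≢ e′ → col e ≢ col e′
    proper {e} {e′} (a , inj₁ q) (a′ , inj₁ q′) e≢e′ =
      proper-l e e′ e≢e′ (trans (endpoint-active left a)
                           (trans (cong inj₁ (trans q (sym q′))) (sym (endpoint-active left a′))))
    proper {e} {e′} (a , inj₂ q) (a′ , inj₂ q′) e≢e′ =
      proper-r e e′ e≢e′ (trans (endpoint-active right a)
                           (trans (cong inj₁ (trans q (sym q′))) (sym (endpoint-active right a′))))
    proper (a , inj₁ refl) (a′ , inj₂ q′) _ with trans (sym (left-side a)) (trans (cong side (sym q′)) (right-side a′))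
    ... | ()
    proper (a , inj₂ refl) (a′ , inj₁ q′) _ with trans (sym (left-side a′)) (trans (cong side q′) (right-side a))
    ... | ()


lookup-injective : ∀ {A : Set} {xs : List A} → Unique xs → Injective _≡_ _≡_ (lookup xs)
lookup-injective {xs = x ∷ xs} (x∉xs ∷ u) {zero}  {zero}  _ = refl
lookup-injective {xs = x ∷ xs} (x∉xs ∷ u) {zero}  {suc j} q = contradiction q (All.lookup x∉xs (∈-lookup j))
lookup-injective {xs = x ∷ xs} (x∉xs ∷ u) {suc i} {zero}  q = contradiction (sym q) (All.lookup x∉xs (∈-lookup i))
lookup-injective {xs = x ∷ xs} (x∉xs ∷ u) {suc i} {suc j} q = cong suc (lookup-injective u q)

-- This is how Defs counts degrees and degree-3 vertices, so count agrees
-- with deg and numDeg3 by definition.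
module Enumeration {N : ℕ} (p : Fin N → Bool) where

  elements : List (Fin N)
  elements = filterᵇ p (allFinL N)

  count : ℕ
  count = length elements

  element : Fin count → Fin N
  element = lookup elements

  element-sat : ∀ i → p (element i) ≡ true
  element-sat i = Equivalence.to T-≡ (proj₂ (∈-filter⁻ (λ x → T? (p x)) {xs = allFinL N} (∈-lookup i)))

  element-injective : Injective _≡_ _≡_ element
  element-injective = lookup-injective (filter⁺ (λ x → T? (p x)) (allFin⁺ N))

  element-surjective : ∀ y → p y ≡ true → ∃[ i ] element i ≡ y
  element-surjective y py = index y∈ , sym (lookup-index y∈)
    where
    y∈ : y ∈ elements
    y∈ = ∈-filter⁺ (λ x → T? (p x)) (∈-allFin y) (Equivalence.from T-≡ py)

  count-≡ : ∀ {d} (g : Fin d → Fin N) → Injective _≡_ _≡_ g →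
    (∀ c → p (g c) ≡ true) → (∀ y → p y ≡ true → ∃[ c ] g c ≡ y) → count ≡ d
  count-≡ g g-inj g-sat g-surj = cantor-schröder-bernstein from-inj to-inj
    where
    from : Fin count → Fin _
    from i = proj₁ (g-surj (element i) (element-sat i))
    from-inj : Injective _≡_ _≡_ from
    from-inj {i} {j} q = element-injective (trans (sym (proj₂ (g-surj (element i) (element-sat i))))
                                             (trans (cong g q) (proj₂ (g-surj (element j) (element-sat j)))))
    to : Fin _ → Fin count
    to c = proj₁ (element-surjective (g c) (g-sat c))
    to-inj : Injective _≡_ _≡_ to
    to-inj {c} {c′} q = g-inj (trans (sym (proj₂ (element-surjective (g c) (g-sat c))))
                                (trans (cong element q) (proj₂ (element-surjective (g c′) (g-sat c′)))))

module _ {a b n : ℕ} (h : Fin a → Fin n) (g : Fin b → Fin n)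
    (h-inj : Injective _≡_ _≡_ h) (g-inj : Injective _≡_ _≡_ g) (disjoint : ∀ i j → h i ≢ g j) where

  private
    h∪g : Fin (a + b) → Fin n
    h∪g i = [ h , g ]′ (splitAt a i)

    splitAt-injective : ∀ {i j x y} → splitAt a i ≡ x → splitAt a j ≡ y → x ≡ y → i ≡ j
    splitAt-injective {i} {j} si sj x≡y =
      trans (sym (join-splitAt a b i)) (trans (cong (join a b) (trans si (trans x≡y (sym sj)))) (join-splitAt a b j))

    h∪g-injective : Injective _≡_ _≡_ h∪g
    h∪g-injective {i} {j} q with splitAt a i in si | splitAt a j in sj
    ... | inj₁ i′ | inj₁ j′ = splitAt-injective si sj (cong inj₁ (h-inj q))
    ... | inj₂ i′ | inj₂ j′ = splitAt-injective si sj (cong inj₂ (g-inj q))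
    ... | inj₁ i′ | inj₂ j′ = contradiction q (disjoint i′ j′)
    ... | inj₂ i′ | inj₁ j′ = contradiction (sym q) (disjoint j′ i′)

    h∪g-misses : ∀ {c} → ¬ (∃[ i ] h i ≡ c) → ¬ (∃[ j ] g j ≡ c) → ∀ k → h∪g k ≢ c
    h∪g-misses ¬h ¬g k with splitAt a k
    ... | inj₁ i = λ q → ¬h (i , q)
    ... | inj₂ j = λ q → ¬g (j , q)

  images-cover : a + b ≡ n → ∀ c → (∃[ i ] h i ≡ c) ⊎ (∃[ j ] g j ≡ c)
  images-cover a+b≡n c with any? (λ i → h i ≟ c) | any? (λ j → g j ≟ c)
  ... | yes hit | _       = inj₁ hit
  ... | no _    | yes hit = inj₂ hit
  ... | no ¬h   | no ¬g   = ⊥-elim (<⇒notInjective (subst (_< suc (a + b)) a+b≡n ≤-refl) f-inj)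
    where
    f : Fin (suc (a + b)) → Fin n
    f = c Vector.∷ h∪g
    f-inj : Injective _≡_ _≡_ f
    f-inj {zero}  {zero}  _ = refl
    f-inj {zero}  {suc j} q = contradiction (sym q) (h∪g-misses ¬h ¬g j)
    f-inj {suc i} {zero}  q = contradiction q (h∪g-misses ¬h ¬g i)
    f-inj {suc i} {suc j} q = cong suc (h∪g-injective q)

injective-surjective : ∀ {n} (h : Fin n → Fin n) → Injective _≡_ _≡_ h → ∀ c → ∃[ i ] h i ≡ c
injective-surjective {n} h h-inj c with images-cover h (λ ()) h-inj (λ { {()} }) (λ _ ()) (+-identityʳ n) c
... | inj₁ hit = hit

not-surjective : ∀ {n} (h : Fin n → Fin (suc n)) → ∃[ m ] (∀ i → h i ≢ m)
not-surjective h with all? (λ c → any? (λ i → h i ≟ c))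
... | no ¬all-hit = let (m , m-missed) = ¬∀⟶∃¬ _ _ (λ c → any? (λ i → h i ≟ c)) ¬all-hit in m , λ i q → m-missed (i , q)
... | yes all-hit = ⊥-elim (<⇒notInjective ≤-refl preimage-inj)
  where
  preimage-inj : Injective _≡_ _≡_ (λ c → proj₁ (all-hit c))
  preimage-inj {c} {c′} q = trans (sym (proj₂ (all-hit c))) (trans (cong h q) (proj₂ (all-hit c′)))

-- Colour codes c : Fin t stand for the colours suc (toℕ c) ∈ {1, …, t}.
ColourSet : ∀ {d t} → (Fin d → Fin t) → ℕ → Set
ColourSet h c = ∃[ i ] suc (toℕ (h i)) ≡ c

IsInterval-⇔ : ∀ {A B : ℕ → Set} → (∀ c → A c ⇔ B c) → IsInterval B → IsInterval A
IsInterval-⇔ A⇔B (a , b , B⇔) = a , b , λ c → mk⇔ (λ x → Equivalence.to (B⇔ c) (Equivalence.to (A⇔B c) x))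
                                                   (λ y → Equivalence.from (A⇔B c) (Equivalence.from (B⇔ c) y))

IsCyclicInterval-⇔ : ∀ {t} {A B : ℕ → Set} → (∀ c → A c ⇔ B c) → IsCyclicInterval t B → IsCyclicInterval t A
IsCyclicInterval-⇔ A⇔B (inj₁ i) = inj₁ (IsInterval-⇔ A⇔B i)
IsCyclicInterval-⇔ A⇔B (inj₂ i) = inj₂ (IsInterval-⇔ (λ c → mk⇔
  (λ { (1≤c , c≤t , ¬A) → 1≤c , c≤t , λ Bc → ¬A (Equivalence.from (A⇔B c) Bc) })
  (λ { (1≤c , c≤t , ¬B) → 1≤c , c≤t , λ Ac → ¬B (Equivalence.to (A⇔B c) Ac) })) i)

empty-interval : ∀ {t} (h : Fin 0 → Fin t) → IsInterval (ColourSet h)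
empty-interval h = 1 , 0 , λ c → mk⇔ (λ { (() , _) }) (λ { (1≤c , c≤0) → contradiction (≤-trans 1≤c c≤0) (λ ()) })

singleton-interval : ∀ {t} (h : Fin 1 → Fin t) → IsInterval (ColourSet h)
singleton-interval h = c₀ , c₀ , λ c →
  mk⇔ (λ { (zero , refl) → ≤-refl , ≤-refl }) (λ { (c₀≤c , c≤c₀) → zero , ≤-antisym c₀≤c c≤c₀ })
  where
  c₀ : ℕ
  c₀ = suc (toℕ (h zero))

block-interval : ∀ {m n} .{{_ : NonZero n}} (b : Fin m) → IsInterval (ColourSet (combine {m} {n} b))
block-interval {m} {n} b = suc (n * toℕ b) , n * toℕ b + n , λ c → mk⇔ to from
  where
  to : ∀ {c} → ColourSet (combine {m} {n} b) c → suc (n * toℕ b) ≤ c × c ≤ n * toℕ b + n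
  to (p , refl) rewrite toℕ-combine b p =
    s≤s (m≤m+n _ _) , subst (_≤ n * toℕ b + n) (+-suc _ _) (+-monoʳ-≤ (n * toℕ b) (toℕ<n p))
  from : ∀ {c} → suc (n * toℕ b) ≤ c × c ≤ n * toℕ b + n → ColourSet (combine {m} {n} b) c
  from {suc c} (s≤s nb≤c , c<nb+n) = fromℕ< c∸nb<n , cong suc offset
    where
    c∸nb<n : c ∸ n * toℕ b < n
    c∸nb<n = m<n+o⇒m∸n<o c (n * toℕ b) c<nb+n
    offset : toℕ (combine b (fromℕ< c∸nb<n)) ≡ c
    offset = trans (toℕ-combine b (fromℕ< c∸nb<n))
                     (trans (cong (n * toℕ b +_) (toℕ-fromℕ< c∸nb<n)) (m+[n∸m]≡n nb≤c))

complement-cyclic : ∀ {t d e} (h : Fin d → Fin t) (g : Fin e → Fin t) →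
  Injective _≡_ _≡_ h → Injective _≡_ _≡_ g → (∀ i j → h i ≢ g j) → d + e ≡ t →
  IsInterval (ColourSet g) → IsCyclicInterval t (ColourSet h)
complement-cyclic {t} h g h-inj g-inj disjoint d+e≡t g-interval = inj₂ (IsInterval-⇔ outside-h g-interval)
  where
  outside-h : ∀ c → (1 ≤ c × c ≤ t × ¬ ColourSet h c) ⇔ ColourSet g c
  outside-h c = mk⇔ to from
    where
    to : 1 ≤ c × c ≤ t × ¬ ColourSet h c → ColourSet g c
    to (s≤s _ , c≤t , ¬h) with images-cover h g h-inj g-inj disjoint d+e≡t (fromℕ< c≤t)
    ... | inj₁ (i , q) = contradiction (i , cong suc (trans (cong toℕ q) (toℕ-fromℕ< c≤t))) ¬h
    ... | inj₂ (j , q) = j , cong suc (trans (cong toℕ q) (toℕ-fromℕ< c≤t))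
    from : ColourSet g c → 1 ≤ c × c ≤ t × ¬ ColourSet h c
    from (j , refl) = s≤s z≤n , toℕ<n (g j) , λ { (i , q) → disjoint i j (toℕ-injective (ℕP.suc-injective q)) }

data GoodDegree : ℕ → Set where
  good₀ : GoodDegree 0
  good₁ : GoodDegree 1
  good₂ : GoodDegree 2
  good₄ : GoodDegree 4
  good₅ : GoodDegree 5
  good₆ : GoodDegree 6

dummies : ℕ → ℕ
dummies 2 = 2
dummies 4 = 1
dummies _ = 0

dummies≤2 : ∀ d → dummies d ≤ 2
dummies≤2 0 = z≤n
dummies≤2 1 = z≤n
dummies≤2 2 = ≤-refl
dummies≤2 3 = z≤n
dummies≤2 4 = s≤s z≤n
dummies≤2 (suc (suc (suc (suc (suc _))))) = z≤n

-- A half of a vertex of degree d meets at most one edge from each of its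
-- ⌈d/2⌉ pairs of neighbours, and all of its dummies: at most three edges.
capacity : ∀ {d} → GoodDegree d → d ≤ (3 ∸ dummies d) * 2
capacity good₀ = z≤n
capacity good₁ = s≤s z≤n
capacity good₂ = ≤-refl
capacity good₄ = ≤-refl
capacity good₅ = ℕP.n≤1+n 5
capacity good₆ = ≤-refl

-- The code combine b p is colour 2b + p + 1, in the block {2b + 1, 2b + 2}.
cyclicAtGoodDegree : ∀ {d} → GoodDegree d → (b : Fin d → Fin 3) (p : Fin d → Fin 2) →
  Injective _≡_ _≡_ (λ i → combine (b i) (p i)) →
  (z : Fin (dummies d) → Fin 3) → Injective _≡_ _≡_ z → (∀ i j → b i ≢ z j) →
  IsCyclicInterval 6 (ColourSet (λ i → combine (b i) (p i)))
cyclicAtGoodDegree good₀ b p _ _ _ _ = inj₁ (empty-interval _)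
cyclicAtGoodDegree good₁ b p _ _ _ _ = inj₁ (singleton-interval _)
cyclicAtGoodDegree good₂ b p code-inj z z-inj b≢z = inj₁ (IsInterval-⇔ same-block (block-interval (b zero)))
  where
  b-constant : ∀ i → b i ≡ b zero
  b-constant i with images-cover {a = 1} (λ _ → b zero) z (λ { {zero} {zero} _ → refl }) z-inj (λ _ → b≢z zero) refl (b i)
  ... | inj₁ (_ , q) = sym q
  ... | inj₂ (j , q) = contradiction (sym q) (b≢z i j)
  p-surjective : ∀ p′ → ∃[ i ] p i ≡ p′
  p-surjective = injective-surjective p λ {i} {j} q →
    code-inj (cong₂ combine (trans (b-constant i) (sym (b-constant j))) q)
  same-block : ∀ c → ColourSet (λ i → combine (b i) (p i)) c ⇔ ColourSet (combine (b zero)) c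
  same-block c = mk⇔ (λ { (i , q) → p i , subst (λ b′ → suc (toℕ (combine b′ (p i))) ≡ c) (b-constant i) q })
                     (λ { (p′ , q) → let (i , pi≡p′) = p-surjective p′ in
                          i , subst (λ b′ → suc (toℕ (combine b′ (p i))) ≡ c) (sym (b-constant i))
                                (subst (λ p″ → suc (toℕ (combine (b zero) p″)) ≡ c) (sym pi≡p′) q) })
cyclicAtGoodDegree good₄ b p code-inj z z-inj b≢z =
  complement-cyclic _ (combine (z zero)) code-inj (λ {x} {y} q → proj₂ (combine-injective (z zero) x (z zero) y q))
    (λ i p′ q → b≢z i zero (proj₁ (combine-injective (b i) (p i) (z zero) p′ q))) refl (block-interval (z zero))
cyclicAtGoodDegree good₅ b p code-inj _ _ _ =
  let (m , missed) = not-surjective (λ i → combine (b i) (p i)) in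
  complement-cyclic _ (λ _ → m) code-inj (λ { {zero} {zero} _ → refl }) (λ i _ → missed i) refl (singleton-interval _)
cyclicAtGoodDegree good₆ b p code-inj _ _ _ =
  complement-cyclic {e = 0} _ (λ ()) code-inj (λ { {()} }) (λ _ ()) refl (empty-interval _)

module BipartiteGraph {N : ℕ} (adj : Fin N → Fin N → Bool) (adj-sym : ∀ x y → adj x y ≡ adj y x)
    (side : Fin N → Bool) (bipartite : ∀ x y → adj x y ≡ true → side x ≢ side y) where

  side-opposite : ∀ {x y} → adj x y ≡ true → side y ≡ not (side x)
  side-opposite {x} {y} a with side x in sx | side y in sy
  ... | false | true  = refl
  ... | true  | false = refl
  ... | false | false = contradiction (trans sx (sym sy)) (bipartite x y a)
  ... | true  | true  = contradiction (trans sx (sym sy)) (bipartite x y a)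

  M : ℕ
  M = N * N

  source : Fin M → Fin N
  source e = proj₁ (remQuot {N} N e)

  target : Fin M → Fin N
  target e = proj₂ (remQuot {N} N e)

  -- Each edge has one code in Fin M: the pair (source, target) with the
  -- source on side false.
  isEdge : Fin M → Bool
  isEdge e = adj (source e) (target e) ∧ not (side (source e))

  edge : Fin N → Fin N → Fin M
  edge x y = if side x then combine y x else combine x y

  source-combine : ∀ x y → source (combine x y) ≡ x
  source-combine x y = cong proj₁ (remQuot-combine {N} {N} x y)

  target-combine : ∀ x y → target (combine x y) ≡ y
  target-combine x y = cong proj₂ (remQuot-combine {N} {N} x y)

  combine-source-target : ∀ e → combine (source e) (target e) ≡ e
  combine-source-target = combine-remQuot {N} N

  isEdge-adj : ∀ {e} → isEdge e ≡ true → adj (source e) (target e) ≡ true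
  isEdge-adj {e} a with adj (source e) (target e)
  ... | true = refl

  isEdge-source : ∀ {e} → isEdge e ≡ true → side (source e) ≡ false
  isEdge-source {e} a with adj (source e) (target e) | side (source e)
  ... | true | false = refl

  isEdge-target : ∀ {e} → isEdge e ≡ true → side (target e) ≡ true
  isEdge-target a = trans (side-opposite (isEdge-adj a)) (cong not (isEdge-source a))

  edge-on-false : ∀ {x} y → side x ≡ false → edge x y ≡ combine x y
  edge-on-false y sx rewrite sx = refl

  edge-on-true : ∀ {x} y → side x ≡ true → edge x y ≡ combine y x
  edge-on-true y sx rewrite sx = refl

  edge-ends : ∀ v u → (side v ≡ false × source (edge v u) ≡ v × target (edge v u) ≡ u)
                    ⊎ (side v ≡ true × source (edge v u) ≡ u × target (edge v u) ≡ v)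
  edge-ends v u with side v in sv
  ... | false = inj₁ (refl , source-combine v u , target-combine v u)
  ... | true  = inj₂ (refl , source-combine u v , target-combine u v)

  edge-source-target : ∀ {e} → isEdge e ≡ true → edge (source e) (target e) ≡ e
  edge-source-target {e} a = trans (edge-on-false (target e) (isEdge-source a)) (combine-source-target e)

  edge-target-source : ∀ {e} → isEdge e ≡ true → edge (target e) (source e) ≡ e
  edge-target-source {e} a = trans (edge-on-true (source e) (isEdge-target a)) (combine-source-target e)

  edge-sym : ∀ {x y} → adj x y ≡ true → edge x y ≡ edge y x
  edge-sym {x} {y} a with side x in sx
  ... | false rewrite side-opposite a | sx = refl
  ... | true  rewrite side-opposite a | sx = refl

  isEdge-combine : ∀ {x y} → adj x y ≡ true → side x ≡ false → isEdge (combine x y) ≡ true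
  isEdge-combine {x} {y} a sx =
    trans (cong₂ (λ s t → adj s t ∧ not (side s)) (source-combine x y) (target-combine x y)) (cong₂ _∧_ a (cong not sx))

  edge-isEdge : ∀ {x y} → adj x y ≡ true → isEdge (edge x y) ≡ true
  edge-isEdge {x} {y} a with side x in sx
  ... | false = isEdge-combine a sx
  ... | true  = isEdge-combine (trans (adj-sym y x) a) (trans (side-opposite a) (cong not sx))

  edge-injective : ∀ {x y y′} → edge x y ≡ edge x y′ → y ≡ y′
  edge-injective {x} {y} {y′} q with side x
  ... | false = proj₂ (combine-injective x y x y′ q)
  ... | true  = proj₁ (combine-injective y x y′ x q)

  -- Split v into the copies (v , z), the edge vu going to the copy (v , label v u).
  module Split {Z : Set} (_≟Z_ : DecidableEquality Z) (label : Fin N → Fin N → Z) where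

    private
      left : Fin M → Fin N × Z
      left e = source e , label (source e) (target e)

      right : Fin M → Fin N × Z
      right e = target e , label (target e) (source e)

      SplitAt : Fin M → Fin N × Z → Set
      SplitAt = At isEdge left right

      edge-end : ∀ v u → left (edge v u) ≡ (v , label v u) ⊎ right (edge v u) ≡ (v , label v u)
      edge-end v u with edge-ends v u
      ... | inj₁ (_ , s , t) = inj₁ (cong₂ (λ x y → x , label x y) s t)
      ... | inj₂ (_ , s , t) = inj₂ (cong₂ (λ x y → x , label x y) t s)

      edge-SplitAt : ∀ {v u} → adj v u ≡ true → SplitAt (edge v u) (v , label v u)
      edge-SplitAt {v} {u} a = edge-isEdge a , edge-end v u

      SplitAt-neighbour : ∀ {e v z} → SplitAt e (v , z) → ∃[ u ] (adj v u ≡ true × label v u ≡ z × edge v u ≡ e)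
      SplitAt-neighbour {e} (a , inj₁ refl) = target e , isEdge-adj a , refl , edge-source-target a
      SplitAt-neighbour {e} (a , inj₂ refl) = source e , trans (adj-sym _ _) (isEdge-adj a) , refl , edge-target-source a

    colourSplit : ∀ {k} → (∀ v z → AtMost (suc k) (λ u → adj v u ≡ true × label v u ≡ z)) →
      Σ[ col ∈ (Fin M → Fin (suc k)) ]
        (∀ {v u u′} → adj v u ≡ true → adj v u′ ≡ true → u ≢ u′ → label v u ≡ label v u′ →
                      col (edge v u) ≢ col (edge v u′))
    colourSplit {k} deg with colourActiveEdges (×P.≡-dec _≟_ _≟Z_) isEdge left right (λ w → side (proj₁ w))
                              isEdge-source isEdge-target degree
      where
      degree : ∀ w → AtMost (suc k) (λ e → SplitAt e w)
      degree (v , z) f f-inj f-at = deg v z (λ c → proj₁ (SplitAt-neighbour (f-at c))) u-inj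
        (λ c → let (_ , a , q , _) = SplitAt-neighbour (f-at c) in a , q)
        where
        u-inj : Injective _≡_ _≡_ (λ c → proj₁ (SplitAt-neighbour (f-at c)))
        u-inj {c} {c′} q = f-inj (trans (sym (proj₂ (proj₂ (proj₂ (SplitAt-neighbour (f-at c))))))
                                   (trans (cong (edge v) q) (proj₂ (proj₂ (proj₂ (SplitAt-neighbour (f-at c′)))))))
    ... | col , proper = col , λ {v} {u} {u′} a a′ u≢u′ q →
      proper (edge-SplitAt a) (subst (λ z → SplitAt (edge v u′) (v , z)) (sym q) (edge-SplitAt a′))
             (λ e≡e′ → u≢u′ (edge-injective e≡e′))

/2-%2-injective : ∀ {a b} → a / 2 ≡ b / 2 → a % 2 ≡ b % 2 → a ≡ b
/2-%2-injective {a} {b} q r = trans (m≡m%n+[m/n]*n a 2) (trans (cong₂ (λ x y → x + y * 2) r q) (sym (m≡m%n+[m/n]*n b 2)))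

toBool : Fin 2 → Bool
toBool zero       = false
toBool (suc zero) = true

toBool-injective : Injective _≡_ _≡_ toBool
toBool-injective {zero}     {zero}     _ = refl
toBool-injective {zero}     {suc zero} ()
toBool-injective {suc zero} {zero}     ()
toBool-injective {suc zero} {suc zero} _ = refl

module GoodDegreeColouring {N : ℕ} (adj : Fin N → Fin N → Bool) (adj-sym : ∀ x y → adj x y ≡ adj y x)
    (side : Fin N → Bool) (bipartite : ∀ x y → adj x y ≡ true → side x ≢ side y)
    (good : ∀ v → GoodDegree (Enumeration.count (adj v))) where

  open BipartiteGraph adj adj-sym side bipartite

  degree : Fin N → ℕ
  degree v = Enumeration.count (adj v)

  module _ (v : Fin N) where
    open Enumeration (adj v) using ()
      renaming (element to neighbour; element-sat to neighbour-adj; element-injective to neighbour-injective;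
                element-surjective to neighbour-surjective) public

  -- The position of u among the neighbours of v (junk 0 if u is not one).
  rank : Fin N → Fin N → ℕ
  rank v u with any? (λ i → neighbour v i ≟ u)
  ... | yes (i , _) = toℕ i
  ... | no _        = 0

  rank-neighbour : ∀ v i → rank v (neighbour v i) ≡ toℕ i
  rank-neighbour v i with any? (λ j → neighbour v j ≟ neighbour v i)
  ... | yes (j , q)  = cong toℕ (neighbour-injective v q)
  ... | no ¬found    = contradiction (i , refl) ¬found

  rank<degree : ∀ {v u} → adj v u ≡ true → rank v u < degree v
  rank<degree {v} a with neighbour-surjective v _ a
  ... | i , refl = subst (_< degree v) (sym (rank-neighbour v i)) (toℕ<n i)

  rank-injective : ∀ {v u u′} → adj v u ≡ true → adj v u′ ≡ true → rank v u ≡ rank v u′ → u ≡ u′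
  rank-injective {v} a a′ q with neighbour-surjective v _ a | neighbour-surjective v _ a′
  ... | i , refl | i′ , refl =
    cong (neighbour v) (toℕ-injective (trans (sym (rank-neighbour v i)) (trans q (rank-neighbour v i′))))

  pairing : Fin N → Fin N → ℕ
  pairing v u = rank v u / 2

  pairs-degree : ∀ v j → AtMost 2 (λ u → adj v u ≡ true × pairing v u ≡ j)
  pairs-degree v j f f-inj f-at = <⇒notInjective ≤-refl parity-inj
    where
    parity : Fin 3 → Fin 2
    parity c = fromℕ< (m%n<n (rank v (f c)) 2)
    parity-inj : Injective _≡_ _≡_ parity
    parity-inj {c} {c′} q = f-inj (rank-injective (proj₁ (f-at c)) (proj₁ (f-at c′))
      (/2-%2-injective (trans (proj₂ (f-at c)) (sym (proj₂ (f-at c′))))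
        (fromℕ<-injective _ _ (m%n<n (rank v (f c)) 2) (m%n<n (rank v (f c′)) 2) q)))

  opaque
    σ : Fin M → Fin 2
    σ = proj₁ (Split.colourSplit ℕP._≟_ pairing pairs-degree)

    σ-proper : ∀ {v u u′} → adj v u ≡ true → adj v u′ ≡ true → u ≢ u′ → pairing v u ≡ pairing v u′ →
               σ (edge v u) ≢ σ (edge v u′)
    σ-proper = proj₂ (Split.colourSplit ℕP._≟_ pairing pairs-degree)

  -- β: each vertex v splits into the halves (v , false) and (v , true)
  -- according to σ, and gets dummies (v , i) joining its two halves.
  half : Fin M → Bool
  half e = toBool (σ e)

  MB : ℕ
  MB = M + N * 2

  real : Fin M → Fin MB
  real e = e ↑ˡ (N * 2)

  dummy : Fin N → Fin 2 → Fin MB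
  dummy v i = M ↑ʳ combine v i

  caseB : ∀ {A : Set} → (Fin M → A) → (Fin N → Fin 2 → A) → Fin MB → A
  caseB f g eb = [ f , (λ t → uncurry g (remQuot {N} 2 t)) ]′ (splitAt M eb)

  caseB-real : ∀ {A : Set} (f : Fin M → A) g e → caseB f g (real e) ≡ f e
  caseB-real f g e rewrite splitAt-↑ˡ M e (N * 2) = refl

  caseB-dummy : ∀ {A : Set} (f : Fin M → A) g v i → caseB f g (dummy v i) ≡ g v i
  caseB-dummy f g v i rewrite splitAt-↑ʳ M (N * 2) (combine v i) = cong (uncurry g) (remQuot-combine {N} {2} v i)

  data EdgeB : Fin MB → Set where
    real-edge  : ∀ e → EdgeB (real e)
    dummy-edge : ∀ v i → EdgeB (dummy v i)

  edgeB : ∀ eb → EdgeB eb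
  edgeB eb with splitAt M eb | join-splitAt M (N * 2) eb
  ... | inj₁ e | refl = real-edge e
  ... | inj₂ t | refl with combine-remQuot {N} 2 t
  ...   | p rewrite sym p = dummy-edge _ _

  isDummy : Fin N → Fin 2 → Bool
  isDummy v i = toℕ i <ᵇ dummies (degree v)

  leftReal : Fin M → Fin N × Bool
  leftReal e = if half e then (target e , true) else (source e , false)

  rightReal : Fin M → Fin N × Bool
  rightReal e = if half e then (source e , true) else (target e , false)

  leftDummy : Fin N → Fin 2 → Fin N × Bool
  leftDummy v _ = v , side v

  rightDummy : Fin N → Fin 2 → Fin N × Bool
  rightDummy v _ = v , not (side v)

  isEdgeB : Fin MB → Bool
  isEdgeB = caseB isEdge isDummy

  leftB : Fin MB → Fin N × Bool
  leftB = caseB leftReal leftDummy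

  rightB : Fin MB → Fin N × Bool
  rightB = caseB rightReal rightDummy

  sideB : Fin N × Bool → Bool
  sideB (v , s) = side v xor s

  leftB-side : ∀ {eb} → isEdgeB eb ≡ true → sideB (leftB eb) ≡ false
  leftB-side {eb} a with edgeB eb
  ... | real-edge e rewrite caseB-real leftReal leftDummy e with half e
  ...   | true  rewrite isEdge-target (trans (sym (caseB-real isEdge isDummy e)) a) = refl
  ...   | false rewrite isEdge-source (trans (sym (caseB-real isEdge isDummy e)) a) = refl
  leftB-side {eb} a | dummy-edge v i rewrite caseB-dummy leftReal leftDummy v i = xor-same (side v)

  rightB-side : ∀ {eb} → isEdgeB eb ≡ true → sideB (rightB eb) ≡ true
  rightB-side {eb} a with edgeB eb
  ... | real-edge e rewrite caseB-real rightReal rightDummy e with half e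
  ...   | true  rewrite isEdge-source (trans (sym (caseB-real isEdge isDummy e)) a) = refl
  ...   | false rewrite isEdge-target (trans (sym (caseB-real isEdge isDummy e)) a) = refl
  rightB-side {eb} a | dummy-edge v i rewrite caseB-dummy rightReal rightDummy v i with side v
  ... | true  = refl
  ... | false = refl

  AtB : Fin MB → Fin N × Bool → Set
  AtB = At isEdgeB leftB rightB

  data AtHalf (v : Fin N) (s : Bool) : Fin MB → Set where
    real-at  : ∀ {u} → adj v u ≡ true → half (edge v u) ≡ s → AtHalf v s (real (edge v u))
    dummy-at : ∀ {i} → isDummy v i ≡ true → AtHalf v s (dummy v i)

  AtHalf-AtB : ∀ {v s eb} → AtHalf v s eb → AtB eb (v , s)
  AtHalf-AtB {v} {s} (real-at {u} a refl) =
    trans (caseB-real isEdge isDummy _) (edge-isEdge a) , ends (edge-ends v u)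
    where
    e : Fin M
    e = edge v u
    ends : (side v ≡ false × source e ≡ v × target e ≡ u) ⊎ (side v ≡ true × source e ≡ u × target e ≡ v) →
           leftB (real e) ≡ (v , half e) ⊎ rightB (real e) ≡ (v , half e)
    ends p rewrite caseB-real leftReal leftDummy e | caseB-real rightReal rightDummy e
      with half e | p
    ... | false | inj₁ (_ , qs , _) = inj₁ (cong (_, false) qs)
    ... | true  | inj₁ (_ , qs , _) = inj₂ (cong (_, true) qs)
    ... | false | inj₂ (_ , _ , qt) = inj₂ (cong (_, false) qt)
    ... | true  | inj₂ (_ , _ , qt) = inj₁ (cong (_, true) qt)
  AtHalf-AtB {v} {s} (dummy-at {i} d) = trans (caseB-dummy isEdge isDummy v i) d , ends s
    where
    ends : ∀ s → leftB (dummy v i) ≡ (v , s) ⊎ rightB (dummy v i) ≡ (v , s)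
    ends s rewrite caseB-dummy leftReal leftDummy v i | caseB-dummy rightReal rightDummy v i
      with side v | s
    ... | false | false = inj₁ refl
    ... | true  | true  = inj₁ refl
    ... | false | true  = inj₂ refl
    ... | true  | false = inj₂ refl

  AtB-AtHalf : ∀ {v s eb} → AtB eb (v , s) → AtHalf v s eb
  AtB-AtHalf {v} {s} {eb} (a , ends) with edgeB eb
  ... | real-edge e = real-ends (trans (sym (caseB-real isEdge isDummy e)) a) (on-ends ends)
    where
    on-ends : leftB (real e) ≡ (v , s) ⊎ rightB (real e) ≡ (v , s) → leftReal e ≡ (v , s) ⊎ rightReal e ≡ (v , s)
    on-ends (inj₁ q) = inj₁ (trans (sym (caseB-real leftReal leftDummy e)) q)
    on-ends (inj₂ q) = inj₂ (trans (sym (caseB-real rightReal rightDummy e)) q)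
    at : ∀ {u} → adj v u ≡ true → edge v u ≡ e → half e ≡ s → AtHalf v s (real e)
    at a q h = subst (λ x → AtHalf v s (real x)) q (real-at a (trans (cong half q) h))
    real-ends : isEdge e ≡ true → leftReal e ≡ (v , s) ⊎ rightReal e ≡ (v , s) → AtHalf v s (real e)
    real-ends ie q with half e in h | q
    ... | false | inj₁ refl = at (isEdge-adj ie) (edge-source-target ie) h
    ... | false | inj₂ refl = at (trans (adj-sym _ _) (isEdge-adj ie)) (edge-target-source ie) h
    ... | true  | inj₁ refl = at (trans (adj-sym _ _) (isEdge-adj ie)) (edge-target-source ie) h
    ... | true  | inj₂ refl = at (isEdge-adj ie) (edge-source-target ie) h
  ... | dummy-edge w i with trans (sym (caseB-dummy isEdge isDummy w i)) a | ends
  ...   | d | inj₁ q with trans (sym (caseB-dummy leftReal leftDummy w i)) q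
  ...     | refl = dummy-at d
  AtB-AtHalf (a , ends) | dummy-edge w i | d | inj₂ q with trans (sym (caseB-dummy rightReal rightDummy w i)) q
  ...     | refl = dummy-at d

  base : Fin N → ℕ
  base v = 3 ∸ dummies (degree v)

  slot : ∀ {v s eb} → AtHalf v s eb → ℕ
  slot {v} (real-at {u} _ _) = pairing v u
  slot {v} (dummy-at {i} _)  = base v + toℕ i

  pairing<base : ∀ {v u} → adj v u ≡ true → pairing v u < base v
  pairing<base {v} a = m<n*o⇒m/o<n (<-≤-trans (rank<degree a) (capacity (good v)))

  dummy<dummies : ∀ {v i} → isDummy v i ≡ true → toℕ i < dummies (degree v)
  dummy<dummies {v} {i} d = <ᵇ⇒< (toℕ i) _ (Equivalence.from T-≡ d)

  slot<3 : ∀ {v s eb} (x : AtHalf v s eb) → slot x < 3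
  slot<3 {v} (real-at a _) = <-≤-trans (pairing<base a) (m∸n≤m 3 (dummies (degree v)))
  slot<3 {v} (dummy-at {i} d) =
    subst (base v + toℕ i <_) (m∸n+n≡m {3} {dummies (degree v)} (≤-trans (dummies≤2 (degree v)) (ℕP.n≤1+n 2)))
          (+-monoʳ-< (base v) (dummy<dummies d))

  slot-injective : ∀ {v s eb eb′} (x : AtHalf v s eb) (y : AtHalf v s eb′) → slot x ≡ slot y → eb ≡ eb′
  slot-injective (real-at {u} a h) (real-at {u′} a′ h′) q with u ≟ u′
  ... | yes refl  = refl
  ... | no u≢u′   = contradiction (toBool-injective (trans h (sym h′))) (σ-proper a a′ u≢u′ q)
  slot-injective (real-at a _) (dummy-at _) q  = contradiction q (ℕP.<⇒≢ (<-≤-trans (pairing<base a) (m≤m+n _ _)))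
  slot-injective (dummy-at _) (real-at a _) q  = contradiction (sym q) (ℕP.<⇒≢ (<-≤-trans (pairing<base a) (m≤m+n _ _)))
  slot-injective {v} (dummy-at _) (dummy-at _) q = cong (dummy v) (toℕ-injective (+-cancelˡ-≡ (base v) _ _ q))

  halves-degree : ∀ w → AtMost 3 (λ eb → AtB eb w)
  halves-degree (v , s) f f-inj f-at = <⇒notInjective ≤-refl slot-inj
    where
    slotOf : Fin 4 → Fin 3
    slotOf c = fromℕ< (slot<3 (AtB-AtHalf (f-at c)))
    slot-inj : Injective _≡_ _≡_ slotOf
    slot-inj {c} {c′} q = f-inj (slot-injective (AtB-AtHalf (f-at c)) (AtB-AtHalf (f-at c′))
      (fromℕ<-injective _ _ (slot<3 (AtB-AtHalf (f-at c))) (slot<3 (AtB-AtHalf (f-at c′))) q))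

  opaque
    β : Fin MB → Fin 3
    β = proj₁ (colourActiveEdges (×P.≡-dec _≟_ _≟ᴮ_) isEdgeB leftB rightB sideB leftB-side rightB-side halves-degree)

    β-proper : ∀ {v s eb eb′} → AtHalf v s eb → AtHalf v s eb′ → eb ≢ eb′ → β eb ≢ β eb′
    β-proper x y =
      proj₂ (colourActiveEdges (×P.≡-dec _≟_ _≟ᴮ_) isEdgeB leftB rightB sideB leftB-side rightB-side halves-degree)
            (AtHalf-AtB x) (AtHalf-AtB y)

  real-injective : ∀ {e e′} → real e ≡ real e′ → e ≡ e′
  real-injective = ↑ˡ-injective (N * 2) _ _

  dummy-injective : ∀ {v i i′} → dummy v i ≡ dummy v i′ → i ≡ i′
  dummy-injective {v} {i} {i′} q = proj₂ (combine-injective v i v i′ (↑ʳ-injective M _ _ q))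

  real≢dummy : ∀ {e v i} → real e ≢ dummy v i
  real≢dummy {e} {v} {i} q
    with trans (sym (splitAt-↑ˡ M e (N * 2))) (trans (cong (splitAt M) q) (splitAt-↑ʳ M (N * 2) (combine v i)))
  ... | ()

  -- π: the edges at v of one β-colour lie in different halves of v, so there
  -- are at most two of them.
  block : Fin N → Fin N → Fin 3
  block v u = β (real (edge v u))

  blocks-degree : ∀ v b → AtMost 2 (λ u → adj v u ≡ true × block v u ≡ b)
  blocks-degree v b f f-inj f-at = <⇒notInjective ≤-refl σ-inj
    where
    σ-inj : Injective _≡_ _≡_ (λ c → σ (edge v (f c)))
    σ-inj {c} {c′} q with f c ≟ f c′
    ... | yes fc≡fc′ = f-inj fc≡fc′
    ... | no fc≢fc′  = contradiction (trans (proj₂ (f-at c)) (sym (proj₂ (f-at c′))))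
      (β-proper (real-at (proj₁ (f-at c)) refl) (real-at (proj₁ (f-at c′)) (cong toBool (sym q)))
                (λ r → fc≢fc′ (edge-injective (real-injective r))))

  opaque
    π : Fin M → Fin 2
    π = proj₁ (Split.colourSplit _≟_ block blocks-degree)

    π-proper : ∀ {v u u′} → adj v u ≡ true → adj v u′ ≡ true → u ≢ u′ → block v u ≡ block v u′ →
               π (edge v u) ≢ π (edge v u′)
    π-proper = proj₂ (Split.colourSplit _≟_ block blocks-degree)

  code : Fin M → Fin 6
  code e = combine (β (real e)) (π e)

  colour : Fin N → Fin N → ℕ
  colour x y = suc (toℕ (code (edge x y)))

  colour-proper : ∀ u v w → adj u v ≡ true → adj u w ≡ true → v ≢ w → colour u v ≢ colour u w
  colour-proper u v w a a′ v≢w q =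
    let (β≡ , π≡) = combine-injective _ _ _ _ (toℕ-injective (ℕP.suc-injective q)) in π-proper a a′ v≢w β≡ π≡

  neighbourBlock : ∀ v → Fin (degree v) → Fin 3
  neighbourBlock v i = block v (neighbour v i)

  neighbourPart : ∀ v → Fin (degree v) → Fin 2
  neighbourPart v i = π (edge v (neighbour v i))

  neighbourCode-injective : ∀ v → Injective _≡_ _≡_ (λ i → combine (neighbourBlock v i) (neighbourPart v i))
  neighbourCode-injective v {i} {j} q with combine-injective _ _ _ _ q | neighbour v i ≟ neighbour v j
  ... | _ , _   | yes same  = neighbour-injective v same
  ... | b≡ , p≡ | no differ = contradiction p≡ (π-proper (neighbour-adj v i) (neighbour-adj v j) differ b≡)

  dummyIndex : ∀ v → Fin (dummies (degree v)) → Fin 2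
  dummyIndex v j = inject≤ j (dummies≤2 (degree v))

  dummyIndex-isDummy : ∀ v j → isDummy v (dummyIndex v j) ≡ true
  dummyIndex-isDummy v j = Equivalence.to T-≡
    (<⇒<ᵇ (subst (_< dummies (degree v)) (sym (toℕ-inject≤ j (dummies≤2 (degree v)))) (toℕ<n j)))

  dummyBlock : ∀ v → Fin (dummies (degree v)) → Fin 3
  dummyBlock v j = β (dummy v (dummyIndex v j))

  dummyBlock-injective : ∀ v → Injective _≡_ _≡_ (dummyBlock v)
  dummyBlock-injective v {j} {j′} q with dummy v (dummyIndex v j) ≟ dummy v (dummyIndex v j′)
  ... | yes same  = inject≤-injective _ _ j j′ (dummy-injective same)
  ... | no differ = contradiction q
    (β-proper {s = false} (dummy-at (dummyIndex-isDummy v j)) (dummy-at (dummyIndex-isDummy v j′)) differ)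

  neighbourBlock≢dummyBlock : ∀ v i j → neighbourBlock v i ≢ dummyBlock v j
  neighbourBlock≢dummyBlock v i j = β-proper (real-at (neighbour-adj v i) refl) (dummy-at (dummyIndex-isDummy v j)) real≢dummy

  coloursAt-neighbours : ∀ v c → coloursAt adj colour v c ⇔ ColourSet (λ i → combine (neighbourBlock v i) (neighbourPart v i)) c
  coloursAt-neighbours v c = mk⇔
    (λ { (u , a , q) → let (i , nb≡u) = neighbour-surjective v u a in i , subst (λ u → colour v u ≡ c) (sym nb≡u) q })
    (λ { (i , q) → neighbour v i , neighbour-adj v i , q })

  cyclic-at : ∀ v → IsCyclicInterval 6 (coloursAt adj colour v)
  cyclic-at v = IsCyclicInterval-⇔ (coloursAt-neighbours v)
    (cyclicAtGoodDegree (good v) (neighbourBlock v) (neighbourPart v) (neighbourCode-injective v)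
                        (dummyBlock v) (dummyBlock-injective v) (neighbourBlock≢dummyBlock v))

  colouring : HasCyclicIntervalColouring adj
  colouring = 6 , colour , record
    { colSym  = λ u v a → cong (λ e → suc (toℕ (code e))) (edge-sym a)
    ; inRange = λ u v a → s≤s z≤n , toℕ<n (code (edge u v))
    ; proper  = colour-proper
    ; cyclic  = cyclic-at
    }


good-degree : ∀ {d} → d ≤ 6 → d ≢ 3 → GoodDegree d
good-degree {0} _ _ = good₀
good-degree {1} _ _ = good₁
good-degree {2} _ _ = good₂
good-degree {3} _ d≢3 = contradiction refl d≢3
good-degree {4} _ _ = good₄
good-degree {5} _ _ = good₅
good-degree {6} _ _ = good₆
good-degree {suc (suc (suc (suc (suc (suc (suc _))))))} (s≤s (s≤s (s≤s (s≤s (s≤s (s≤s ())))))) _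

toℕ-≡ᵇ-sound : ∀ {m} {u w : Fin m} → (toℕ u ≡ᵇ toℕ w) ≡ true → u ≡ w
toℕ-≡ᵇ-sound {u = u} {w} q = toℕ-injective (≡ᵇ⇒≡ (toℕ u) (toℕ w) (Equivalence.from T-≡ q))

toℕ-≡ᵇ-refl : ∀ {m} (u : Fin m) → (toℕ u ≡ᵇ toℕ u) ≡ true
toℕ-≡ᵇ-refl u = Equivalence.to T-≡ (≡⇒≡ᵇ (toℕ u) (toℕ u) refl)

≡ᵇ-sym : ∀ a b → (a ≡ᵇ b) ≡ (b ≡ᵇ a)
≡ᵇ-sym zero    zero    = refl
≡ᵇ-sym zero    (suc b) = refl
≡ᵇ-sym (suc a) zero    = refl
≡ᵇ-sym (suc a) (suc b) = ≡ᵇ-sym a b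

module PendantEdges {n : ℕ} (G : Graph n) (side : Fin n → Bool)
    (bipartite : ∀ u v → adj G u v ≡ true → side u ≢ side v) (maxDeg : MaxDegAtMost G 6) where

  open Enumeration (λ v → deg G v ≡ᵇ 3) using ()
    renaming (count to k; element to att; element-sat to att-sat; element-injective to att-injective;
              element-surjective to att-surjective) public

  adj′ : Fin (n + k) → Fin (n + k) → Bool
  adj′ = pendAdj {n} {k} G att

  data Vertex : Fin (n + k) → Set where
    original : ∀ u → Vertex (u ↑ˡ k)
    pendant  : ∀ j → Vertex (n ↑ʳ j)

  vertex : ∀ x → Vertex x
  vertex x with splitAt n x | join-splitAt n k x
  ... | inj₁ u | refl = original u
  ... | inj₂ j | refl = pendant j

  adj′-original : ∀ u w → adj′ (u ↑ˡ k) (w ↑ˡ k) ≡ adj G u w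
  adj′-original u w rewrite splitAt-↑ˡ n u k | splitAt-↑ˡ n w k = refl

  adj′-to-pendant : ∀ u j → adj′ (u ↑ˡ k) (n ↑ʳ j) ≡ (toℕ u ≡ᵇ toℕ (att j))
  adj′-to-pendant u j rewrite splitAt-↑ˡ n u k | splitAt-↑ʳ n k j = refl

  adj′-from-pendant : ∀ j u → adj′ (n ↑ʳ j) (u ↑ˡ k) ≡ (toℕ (att j) ≡ᵇ toℕ u)
  adj′-from-pendant j u rewrite splitAt-↑ˡ n u k | splitAt-↑ʳ n k j = refl

  adj′-pendants : ∀ j j′ → adj′ (n ↑ʳ j) (n ↑ʳ j′) ≡ false
  adj′-pendants j j′ rewrite splitAt-↑ʳ n k j | splitAt-↑ʳ n k j′ = refl

  adj′-sym : ∀ x y → adj′ x y ≡ adj′ y x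
  adj′-sym x y with vertex x | vertex y
  ... | original u | original w = trans (adj′-original u w) (trans (symm G u w) (sym (adj′-original w u)))
  ... | original u | pendant j  = trans (adj′-to-pendant u j) (trans (≡ᵇ-sym (toℕ u) _) (sym (adj′-from-pendant j u)))
  ... | pendant j  | original u = trans (adj′-from-pendant j u) (trans (≡ᵇ-sym _ (toℕ u)) (sym (adj′-to-pendant u j)))
  ... | pendant j  | pendant j′ = trans (adj′-pendants j j′) (sym (adj′-pendants j′ j))

  side′ : Fin (n + k) → Bool
  side′ x = [ side , (λ j → not (side (att j))) ]′ (splitAt n x)

  side′-original : ∀ u → side′ (u ↑ˡ k) ≡ side u
  side′-original u rewrite splitAt-↑ˡ n u k = refl

  side′-pendant : ∀ j → side′ (n ↑ʳ j) ≡ not (side (att j))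
  side′-pendant j rewrite splitAt-↑ʳ n k j = refl

  bipartite′ : ∀ x y → adj′ x y ≡ true → side′ x ≢ side′ y
  bipartite′ x y a with vertex x | vertex y
  ... | original u | original w = λ q → bipartite u w (trans (sym (adj′-original u w)) a)
                                          (trans (sym (side′-original u)) (trans q (side′-original w)))
  ... | original u | pendant j with toℕ-≡ᵇ-sound {u = u} {att j} (trans (sym (adj′-to-pendant u j)) a)
  ...   | refl = λ q → not-¬ refl (trans (sym (side′-original u)) (trans q (side′-pendant j)))
  bipartite′ x y a | pendant j | original u with toℕ-≡ᵇ-sound {u = att j} {u} (trans (sym (adj′-from-pendant j u)) a)
  ...   | refl = λ q → not-¬ refl (trans (sym (side′-original u)) (trans (sym q) (side′-pendant j)))
  bipartite′ x y a | pendant j | pendant j′ = contradiction (trans (sym a) (adj′-pendants j j′)) (λ ())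

  ↑ˡ≢↑ʳ : ∀ {u j} → u ↑ˡ k ≢ n ↑ʳ j
  ↑ˡ≢↑ʳ {u} {j} q with trans (sym (splitAt-↑ˡ n u k)) (trans (cong (splitAt n) q) (splitAt-↑ʳ n k j))
  ... | ()

  att-deg : ∀ j → deg G (att j) ≡ 3
  att-deg j = ≡ᵇ⇒≡ _ 3 (Equivalence.from T-≡ (att-sat j))

  pendant-at : ∀ {u j} → adj′ (u ↑ˡ k) (n ↑ʳ j) ≡ true → att j ≡ u
  pendant-at {u} {j} a = sym (toℕ-≡ᵇ-sound {u = u} {att j} (trans (sym (adj′-to-pendant u j)) a))

  module _ (u : Fin n) where
    open Enumeration (adj G u) using () renaming (element to nbr; element-sat to nbr-adj;
      element-injective to nbr-injective; element-surjective to nbr-surjective)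
    open Enumeration (adj′ (u ↑ˡ k)) using (count-≡)

    degree-unchanged : deg G u ≢ 3 → Enumeration.count (adj′ (u ↑ˡ k)) ≡ deg G u
    degree-unchanged d≢3 = count-≡ g (λ q → nbr-injective (↑ˡ-injective k _ _ q)) g-adj g-surj
      where
      g : Fin (deg G u) → Fin (n + k)
      g c = nbr c ↑ˡ k
      g-adj : ∀ c → adj′ (u ↑ˡ k) (g c) ≡ true
      g-adj c = trans (adj′-original u (nbr c)) (nbr-adj c)
      g-surj : ∀ y → adj′ (u ↑ˡ k) y ≡ true → ∃[ c ] g c ≡ y
      g-surj y a with vertex y
      ... | original w = let (c , q) = nbr-surjective w (trans (sym (adj′-original u w)) a) in c , cong (_↑ˡ k) q
      ... | pendant j  = contradiction (subst (λ v → deg G v ≡ 3) (pendant-at a) (att-deg j)) d≢3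

    degree3-becomes-4 : (d≡3 : deg G u ≡ 3) → Enumeration.count (adj′ (u ↑ˡ k)) ≡ 4
    degree3-becomes-4 d≡3 = trans (count-≡ g g-inj g-adj g-surj) (cong suc d≡3)
      where
      ju : Fin k
      ju = proj₁ (att-surjective u (Equivalence.to T-≡ (≡⇒≡ᵇ _ 3 d≡3)))
      att-ju : att ju ≡ u
      att-ju = proj₂ (att-surjective u (Equivalence.to T-≡ (≡⇒≡ᵇ _ 3 d≡3)))
      g : Fin (suc (deg G u)) → Fin (n + k)
      g zero    = n ↑ʳ ju
      g (suc c) = nbr c ↑ˡ k
      g-inj : Injective _≡_ _≡_ g
      g-inj {zero}  {zero}  _ = refl
      g-inj {zero}  {suc c} q = contradiction (sym q) ↑ˡ≢↑ʳ
      g-inj {suc c} {zero}  q = contradiction q ↑ˡ≢↑ʳ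
      g-inj {suc c} {suc c′} q = cong suc (nbr-injective (↑ˡ-injective k _ _ q))
      g-adj : ∀ c → adj′ (u ↑ˡ k) (g c) ≡ true
      g-adj zero    = trans (adj′-to-pendant u ju) (subst (λ w → (toℕ u ≡ᵇ toℕ w) ≡ true) (sym att-ju) (toℕ-≡ᵇ-refl u))
      g-adj (suc c) = trans (adj′-original u (nbr c)) (nbr-adj c)
      g-surj : ∀ y → adj′ (u ↑ˡ k) y ≡ true → ∃[ c ] g c ≡ y
      g-surj y a with vertex y
      ... | original w = let (c , q) = nbr-surjective w (trans (sym (adj′-original u w)) a) in suc c , cong (_↑ˡ k) q
      ... | pendant j  = zero , cong (n ↑ʳ_) (att-injective (trans att-ju (sym (pendant-at a))))

  pendant-degree : ∀ j → Enumeration.count (adj′ (n ↑ʳ j)) ≡ 1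
  pendant-degree j = Enumeration.count-≡ (adj′ (n ↑ʳ j)) (λ _ → att j ↑ˡ k) (λ { {zero} {zero} _ → refl })
    (λ _ → trans (adj′-from-pendant j (att j)) (toℕ-≡ᵇ-refl (att j))) surj
    where
    surj : ∀ y → adj′ (n ↑ʳ j) y ≡ true → ∃[ c ] att j ↑ˡ k ≡ y
    surj y a with vertex y
    ... | original w = zero , cong (_↑ˡ k) (toℕ-≡ᵇ-sound {u = att j} {w} (trans (sym (adj′-from-pendant j w)) a))
    ... | pendant j′ = contradiction (trans (sym a) (adj′-pendants j j′)) (λ ())

  good′ : ∀ x → GoodDegree (Enumeration.count (adj′ x))
  good′ x with vertex x
  ... | pendant j = subst GoodDegree (sym (pendant-degree j)) good₁
  ... | original u with deg G u ℕP.≟ 3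
  ...   | no d≢3  = subst GoodDegree (sym (degree-unchanged u d≢3)) (good-degree (maxDeg u) d≢3)
  ...   | yes d≡3 = subst GoodDegree (sym (degree3-becomes-4 u d≡3)) good₄

corollary5 : ∀ (n : ℕ) (G : Graph n) → Bipartite G → MaxDegAtMost G 6 →
    DefcAtMost G (numDeg3 G)
corollary5 n G (side , bipartite) maxDeg =
  k , ≤-refl , att , GoodDegreeColouring.colouring adj′ adj′-sym side′ bipartite′ good′
  where
  open PendantEdges G side bipartite maxDeg
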